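{- Let $\ast$ be a uniformity preserving operation on a finite set $\mathcal{X}$. Then: (1) Every quasigroup operation is ergodic, and every ergodic operation is irreducible. (2) If $\ast$ is not irreducible, there exist disjoint nonempty $A_1,A_2\subset\mathcal{X}$ with $A_1\cup A_2=\mathcal{X}$, $A_1\ast\mathcal{X}=A_1$ and $A_2\ast\mathcal{X}=A_2$. (3) If $\ast$ is irreducible, $\mathrm{per}(\ast,a)=\mathrm{per}(\ast)$ for all $a\in\mathcal{X}$. (4) If $\ast$ is irreducible and $n=\mathrm{per}(\ast)$, there exists a partition $\{H_0,\dots,H_{n-1}\}$ of $\mathcal{X}$ with $H_i\ast\mathcal{X}=H_{i+1\bmod n}$ for all $0\le i<n$ and $|H_0|=\dots=|H_{n-1}|$, and there exists an integer $d>0$ such that for every $0\le i<n$ every element of $H_i$ is $\ast$-connectable to every element of $H_{i+d\bmod n}$ in $d$ steps; moreover, if $\mathrm{con}(\ast)$ denotes the least such $d$, then for every $s\geq\mathrm{con}(\ast)$ and every $0\le i<n$, every element of $H_i$ is $\ast$-connectable to every element of $H_{i+s\bmod n}$ in $s$ steps. (5) If $\ast$ is irreducible, then $\mathrm{per}(\ast)=1$ if and only if $\ast$ is ergodic. (6) If $\ast$ is ergodic, all elements of $\mathcal{X}$ are $\ast$-connectable to each other in $s$ steps for every $s\geq\mathrm{con}(\ast)$. (7) If $\ast$ is ergodic, $\mathrm{con}(\ast)=1$ if and only if $\ast$ is a quasigroup operation. (8) If $\ast$ is irreducible (resp. ergodic), then $/^{\ast}$ is irreducible (resp. ergodic).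
   Context: A binary operation $\ast$ on finite $\mathcal{X}$ is uniformity preserving if for every $b$ the map $x\mapsto x\ast b$ is a bijection; then $a/^{\ast}b$ denotes the unique $c$ with $a=c\ast b$ (the inverse operation $/^{\ast}$, also uniformity preserving). $\ast$ is a quasigroup operation if additionally each map $x\mapsto b\ast x$ is bijective. For $A,B\subset\mathcal{X}$, $A\ast B=\{a\ast b:a\in A,b\in B\}$. For $l>0$, $a$ is $\ast$-connectable to $b$ in $l$ steps if there are $x_0,\dots,x_{l-1}$ with $(\cdots((a\ast x_0)\ast x_1)\cdots)\ast x_{l-1}=b$; $a$ is $\ast$-connectable to $b$ if this holds for some $l>0$. A uniformity preserving $\ast$ is irreducible if every element is $\ast$-connectable to every element; then $\mathrm{per}(\ast,a)=\gcd\{l>0: a\text{ connectable to } a\text{ in }l\text{ steps}\}$ and $\mathrm{per}(\ast)=\gcd\{\mathrm{per}(\ast,a):a\in\mathcal{X}\}$. $\ast$ is ergodic if there exists $l>0$ such that all elements are $\ast$-connectable to each other in $l$ steps; for ergodic $\ast$, $\mathrm{con}(\ast)$ is the least such $l$ (this agrees with the definition in (4) when $\ast$ is viewed as irreducible). -}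

module Defs where

open import Data.Nat using (ℕ; zero; suc; _+_; _<_; _≤_; _%_)
open import Data.Nat.Divisibility using (_∣_)
open import Data.Fin using (Fin; toℕ)
open import Data.Fin.Subset using (Subset; _∈_; Nonempty; _∩_; _∪_; ⊥; ⊤; ∣_∣)
open import Data.Vec using (Vec; []; _∷_; tabulate)
open import Data.Bool using (Bool)
open import Data.Product using (Σ; ∃; ∃-syntax; _×_; _,_; proj₁; proj₂)
open import Function.Definitions using (Bijective)
open import Function.Bundles using (_⇔_)
open import Relation.Binary.PropositionalEquality using (_≡_)
open import Relation.Nullary using (¬_; does)
import Data.Fin as F

Op : ℕ → Set
Op m = Fin m → Fin m → Fin m

module _ {m : ℕ} (_*_ : Op m) where

  UniformityPreserving : Set
  UniformityPreserving = ∀ b → Bijective _≡_ _≡_ (λ x → x * b)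

  Quasigroup : Set
  Quasigroup = UniformityPreserving × (∀ b → Bijective _≡_ _≡_ (λ x → b * x))

  run : ∀ {l} → Fin m → Vec (Fin m) l → Fin m
  run a []       = a
  run a (x ∷ xs) = run (a * x) xs

  ConnIn : ℕ → Fin m → Fin m → Set
  ConnIn l a b = 0 < l × Σ (Vec (Fin m) l) (λ xs → run a xs ≡ b)

  Connectable : Fin m → Fin m → Set
  Connectable a b = ∃[ l ] ConnIn l a b

  Irreducible : Set
  Irreducible = ∀ a b → Connectable a b

  Ergodic : Set
  Ergodic = ∃[ l ] (0 < l × (∀ a b → ConnIn l a b))

  IsCon : ℕ → Set
  IsCon c = (0 < c × (∀ a b → ConnIn c a b))
          × (∀ l → 0 < l → (∀ a b → ConnIn l a b) → c ≤ l)

  -- p = per(*, a) = gcd { l > 0 : a connectable to a in l steps }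
  -- (gcd of a set of naturals, characterised in the divisibility order)
  IsPerAt : Fin m → ℕ → Set
  IsPerAt a p = (∀ l → ConnIn l a a → p ∣ l)
              × (∀ d → (∀ l → ConnIn l a a → d ∣ l) → d ∣ p)

  IsPer : ℕ → Set
  IsPer n = (∀ a p → IsPerAt a p → n ∣ p)
          × (∀ d → (∀ a p → IsPerAt a p → d ∣ p) → d ∣ n)

  StarAllEq : Subset m → Set
  StarAllEq A = ∀ y → (y ∈ A ⇔ (∃[ a ] ∃[ x ] (a ∈ A × a * x ≡ y)))

rdiv : ∀ {m} (_*_ : Op m) → UniformityPreserving _*_ → Op m
rdiv _*_ up a b = proj₁ (proj₂ (up b) a)

-- (i + d) mod n   (n = 0 never occurs in the uses below, since per(*) > 0)
addMod : ℕ → ℕ → ℕ → ℕ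
addMod zero    i d = i + d
addMod (suc k) i d = (i + d) % suc k

-- the block H_i = { x : h x ≡ i } of the partition given by a labelling h
block : ∀ {m n} → (Fin m → Fin n) → Fin n → Subset m
block h i = tabulate (λ x → does (h x F.≟ i))

module _ {m : ℕ} (_*_ : Op m) (up : UniformityPreserving _*_) where

  Part1 : Set
  Part1 = (Quasigroup _*_ → Ergodic _*_) × (Ergodic _*_ → Irreducible _*_)

  Part2 : Set
  Part2 = ¬ Irreducible _*_ →
          ∃[ A₁ ] ∃[ A₂ ] ( A₁ ∩ A₂ ≡ ⊥ × Nonempty A₁ × Nonempty A₂ × A₁ ∪ A₂ ≡ ⊤
                          × StarAllEq _*_ A₁ × StarAllEq _*_ A₂ )

  Part3 : Set
  Part3 = Irreducible _*_ → ∀ n → IsPer _*_ n → ∀ a p → IsPerAt _*_ a p → p ≡ n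

  -- with a partition {H_0,…,H_{n-1}} given by h : 𝒳 → Fin n (H_i = h⁻¹(i)),
  -- GoodD h d : every element of H_i is connectable to every element of
  -- H_{i+d mod n} in d steps, for all i (and d > 0)
  GoodD : ∀ {n} → (Fin m → Fin n) → ℕ → Set
  GoodD {n} h d = 0 < d × (∀ a b → toℕ (h b) ≡ addMod n (toℕ (h a)) d → ConnIn _*_ d a b)

  Part4 : Set
  Part4 = Irreducible _*_ → ∀ n → IsPer _*_ n →
          ∃[ h ] ( (∀ i → Nonempty (block {m} {n} h i))
                 × (∀ (i : Fin n) y → (toℕ (h y) ≡ addMod n (toℕ i) 1
                                       ⇔ (∃[ a ] ∃[ x ] (h a ≡ i × a * x ≡ y))))
                 × (∀ i j → ∣ block h i ∣ ≡ ∣ block h j ∣)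
                 × (∃[ d ] GoodD h d)
                 × (∀ c → (GoodD h c × (∀ d → GoodD h d → c ≤ d)) →
                      ∀ s → c ≤ s → GoodD h s) )

  Part5 : Set
  Part5 = Irreducible _*_ → ∀ n → IsPer _*_ n → (n ≡ 1 ⇔ Ergodic _*_)

  Part6 : Set
  Part6 = Ergodic _*_ → ∀ c → IsCon _*_ c → ∀ s → c ≤ s → ∀ a b → ConnIn _*_ s a b

  Part7 : Set
  Part7 = Ergodic _*_ → ∀ c → IsCon _*_ c → (c ≡ 1 ⇔ Quasigroup _*_)

  Part8 : Set
  Part8 = (Irreducible _*_ → Irreducible (rdiv _*_ up))
        × (Ergodic _*_ → Ergodic (rdiv _*_ up))

-- View ⊛ as the digraph with edges x → x ⊛ z.  Since every right translation is a
-- permutation, a set of states closed under the edges is also closed under reversed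
-- edges (it cannot grow), which splits a reducible operation into two invariant blocks.
-- For irreducible ⊛ fix a₀ and walks a₀ ⇝ x ⇝ a₀ of lengths out x and back x.  The gcd p
-- of the finitely many closed walks a₀ ⇝ x → x ⊛ z ⇝ a₀ divides out x + l + back y for
-- every walk x ⇝ y of length l, so it is the period at a₀, and out x mod p is a label
-- advanced by exactly one along every edge; its fibres form the cyclic partition.  By
-- Bézout, closed walks at a₀ exist for all large multiples of p, and concatenating
-- back a, such a loop and out b connects any two elements with matching labels in a
-- common number of steps.
module Submission where

open import Defs
open import Data.Nat using (ℕ; _<_)
open import Data.Product using (_×_)

open import Data.Nat using (zero; suc; _+_; _*_; _∸_; _≤_; _≤′_; ≤′-refl; ≤′-step;
  z≤n; s≤s; z<s; _%_; _/_; NonZero; >-nonZero)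
open import Data.Nat.Properties hiding (_≟_)
open import Data.Nat.Divisibility
open import Data.Nat.DivMod
open import Data.Nat.GCD using (gcd; gcd[m,n]∣m; gcd[m,n]∣n; gcd-greatest; gcd-GCD; module Bézout)
open import Data.Nat.GeneralisedArithmetic using (fold)
open import Data.Nat.Tactic.RingSolver using (solve-∀)
open import Algebra.Properties.CommutativeMonoid.Sum +-0-commutativeMonoid using (sum; sum-permute)
open import Data.Bool using (Bool; true; false)
open import Data.Fin using (Fin; zero; suc; toℕ; fromℕ<; punchOut; _≟_)
open import Data.Fin.Properties
  using (toℕ-injective; toℕ-fromℕ<; toℕ<n; any?; punchOut-injective; injective⇒≤)
open import Data.Fin.Permutation using (Permutation′; permutation; _⟨$⟩ʳ_)
open import Data.Fin.Subset using (Subset; Nonempty; _∈_; _⊆_; _⊂_; ∣_∣; _∪_; ∁; ⁅_⁆)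
open import Data.Fin.Subset.Properties using (_∈?_; p⊂q⇒∣p∣<∣q∣; ∣p∣≤n; ⊆-antisym; p⊆p∪q;
  x∈p∪q⁺; x∈p∪q⁻; x∈⁅x⁆; x∈⁅y⁆⇒x≡y; x∉p⇒x∈∁p; x∈∁p⇒x∉p; p∪∁p≡⊤; ∩-inverseʳ)
open import Data.Vec using (Vec; []; _∷_; _++_; _∷ʳ_; replicate; tabulate; lookup)
open import Data.Vec.Properties using (lookup∘tabulate; tabulate∘lookup; lookup⇒[]=; []=⇒lookup)
open import Data.Product using (Σ; ∃-syntax; _,_; proj₁; proj₂)
open import Data.Sum using (_⊎_; inj₁; inj₂)
open import Data.Unit using (⊤; tt)
open import Function using (_∘_)
open import Function.Bundles using (_⇔_; mk⇔; Equivalence)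
open import Function.Definitions using (Injective)
open import Relation.Binary.PropositionalEquality
open import Relation.Nullary using (yes; no; does; ¬?; contradiction)
open import Relation.Nullary.Decidable using (dec-true; decidable-stable; _×-dec_)
open import Relation.Unary using (Decidable)

open Equivalence using (to; from)

-- Finite sets

injective⇒surjective : ∀ {n} {f : Fin n → Fin n} → Injective _≡_ _≡_ f → ∀ y → ∃[ x ] f x ≡ y
injective⇒surjective {suc n} {f} f-injective y with any? (λ x → f x ≟ y)
... | yes hit  = hit
... | no ¬hit = contradiction (injective⇒≤ punched-injective) (<-irrefl refl)
  where
  avoids : ∀ x → y ≢ f x
  avoids x y≡fx = ¬hit (x , sym y≡fx)
  punched-injective : Injective _≡_ _≡_ (λ x → punchOut (avoids x))
  punched-injective e = f-injective (punchOut-injective (avoids _) (avoids _) e)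

section⇒injective : ∀ {n} {f g : Fin n → Fin n} → (∀ y → f (g y) ≡ y) → Injective _≡_ _≡_ f
section⇒injective {f = f} {g} fg {x} {y} fx≡fy
  with injective⇒surjective g-injective x | injective⇒surjective g-injective y
  where
  g-injective : Injective _≡_ _≡_ g
  g-injective {i} {j} gi≡gj = trans (sym (fg i)) (trans (cong f gi≡gj) (fg j))
... | x′ , refl | y′ , refl = cong g (trans (sym (fg x′)) (trans fx≡fy (fg y′)))

∈-tabulate-does : ∀ {n} {P : Fin n → Set} (P? : Decidable P) {x} →
                  x ∈ tabulate (λ y → does (P? y)) ⇔ P x
∈-tabulate-does {P = P} P? {x} =
  mk⇔ member (λ Px → lookup⇒[]= x _ (trans (lookup∘tabulate _ x) (dec-true (P? x) Px)))
  where
  member : x ∈ tabulate (λ y → does (P? y)) → P x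
  member x∈ with P? x | trans (sym (lookup∘tabulate (λ y → does (P? y)) x)) ([]=⇒lookup x∈)
  ... | yes Px | _ = Px

preimage : ∀ {n} → (Fin n → Fin n) → Subset n → Subset n
preimage f p = tabulate (lookup p ∘ f)

∈-preimage : ∀ {n} (f : Fin n → Fin n) (p : Subset n) {x} → x ∈ preimage f p ⇔ f x ∈ p
∈-preimage f p {x} = mk⇔
  (λ x∈ → lookup⇒[]= (f x) p (trans (sym (lookup∘tabulate (lookup p ∘ f) x)) ([]=⇒lookup x∈)))
  (λ fx∈ → lookup⇒[]= x _ (trans (lookup∘tabulate (lookup p ∘ f) x) ([]=⇒lookup fx∈)))

∣preimage∣ : ∀ {n} (π : Permutation′ n) (p : Subset n) → ∣ preimage (π ⟨$⟩ʳ_) p ∣ ≡ ∣ p ∣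
∣preimage∣ π p = begin
  ∣ tabulate (lookup p ∘ (π ⟨$⟩ʳ_)) ∣  ≡⟨ ∣tabulate∣≡sum (lookup p ∘ (π ⟨$⟩ʳ_)) ⟩
  sum (bit ∘ lookup p ∘ (π ⟨$⟩ʳ_))     ≡⟨ sum-permute (bit ∘ lookup p) π ⟨
  sum (bit ∘ lookup p)                 ≡⟨ ∣tabulate∣≡sum (lookup p) ⟨
  ∣ tabulate (lookup p) ∣              ≡⟨ cong ∣_∣ (tabulate∘lookup p) ⟩
  ∣ p ∣                                ∎
  where
  open ≡-Reasoning
  bit : Bool → ℕ
  bit true  = 1
  bit false = 0
  ∣tabulate∣≡sum : ∀ {n} (f : Fin n → Bool) → ∣ tabulate f ∣ ≡ sum (bit ∘ f)
  ∣tabulate∣≡sum {zero}  f = refl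
  ∣tabulate∣≡sum {suc n} f with f zero | ∣tabulate∣≡sum (λ i → f (suc i))
  ... | true  | e = cong suc e
  ... | false | e = e

⊆⇒⊇⊎⊂ : ∀ {n} {p q : Subset n} → p ⊆ q → q ⊆ p ⊎ p ⊂ q
⊆⇒⊇⊎⊂ {p = p} {q} p⊆q with any? (λ x → (x ∈? q) ×-dec ¬? (x ∈? p))
... | yes (x , x∈q , x∉p) = inj₂ (p⊆q , x , x∈q , x∉p)
... | no ∄ = inj₁ λ {x} x∈q → decidable-stable (x ∈? p) (λ x∉p → ∄ (x , x∈q , x∉p))

⊆∧∣≡∣⇒⊇ : ∀ {n} {p q : Subset n} → p ⊆ q → ∣ p ∣ ≡ ∣ q ∣ → q ⊆ p
⊆∧∣≡∣⇒⊇ p⊆q ∣p∣≡∣q∣ with ⊆⇒⊇⊎⊂ p⊆q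
... | inj₁ q⊆p = q⊆p
... | inj₂ p⊂q = contradiction ∣p∣≡∣q∣ (<⇒≢ (p⊂q⇒∣p∣<∣q∣ p⊂q))

module Inflationary {n : ℕ} (F : Subset n → Subset n) (F-inflationary : ∀ p → p ⊆ F p) where

  fold-⊇ : ∀ p k → p ⊆ fold p F k
  fold-⊇ p zero    = λ x∈ → x∈
  fold-⊇ p (suc k) = F-inflationary (fold p F k) ∘ fold-⊇ p k

  private
    Stable : Subset n → Set
    Stable p = F p ⊆ p

    stable-F : ∀ {p} → Stable p → Stable (F p)
    stable-F {p} st = subst Stable (⊆-antisym (F-inflationary p) st) st

    stable⊎large : ∀ p k → Stable (fold p F k) ⊎ k ≤ ∣ fold p F k ∣
    stable⊎large p zero = inj₂ z≤n
    stable⊎large p (suc k) with stable⊎large p k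
    ... | inj₁ st = inj₁ (stable-F st)
    ... | inj₂ large with ⊆⇒⊇⊎⊂ (F-inflationary (fold p F k))
    ...   | inj₁ st  = inj₁ (stable-F st)
    ...   | inj₂ grow = inj₂ (<-≤-trans (s≤s large) (p⊂q⇒∣p∣<∣q∣ grow))

  fold-stable : ∀ p → F (fold p F (suc n)) ⊆ fold p F (suc n)
  fold-stable p with stable⊎large p (suc n)
  ... | inj₁ st    = st
  ... | inj₂ large = contradiction (∣p∣≤n (fold p F (suc n))) (<⇒≱ large)

-- Arithmetic

gcdOf : ∀ {n} → (Fin n → ℕ) → ℕ
gcdOf {zero}  f = 0
gcdOf {suc n} f = gcd (f zero) (gcdOf (λ i → f (suc i)))

gcdOf-∣ : ∀ {n} (f : Fin n → ℕ) i → gcdOf f ∣ f i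
gcdOf-∣ f zero    = gcd[m,n]∣m _ _
gcdOf-∣ f (suc i) = ∣-trans (gcd[m,n]∣n (f zero) _) (gcdOf-∣ (λ i → f (suc i)) i)

gcdOf-greatest : ∀ {n d} (f : Fin n → ℕ) → (∀ i → d ∣ f i) → d ∣ gcdOf f
gcdOf-greatest {zero}  f d∣f = _ ∣0
gcdOf-greatest {suc n} f d∣f =
  gcd-greatest (d∣f zero) (gcdOf-greatest (λ i → f (suc i)) (λ i → d∣f (suc i)))

≤-sum : ∀ {n} (f : Fin n → ℕ) i → f i ≤ sum f
≤-sum f zero    = m≤m+n _ _
≤-sum f (suc i) = ≤-trans (≤-sum (λ i → f (suc i)) i) (m≤n+m _ _)

addMod≡% : ∀ n .{{_ : NonZero n}} i d → addMod n i d ≡ (i + d) % n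
addMod≡% (suc n) i d = refl

module _ {n : ℕ} .{{_ : NonZero n}} where

  %-absorbˡ : ∀ a b → (a % n + b) % n ≡ (a + b) % n
  %-absorbˡ a b = begin
    (a % n + b) % n          ≡⟨ %-distribˡ-+ (a % n) b n ⟩
    (a % n % n + b % n) % n  ≡⟨ cong (λ r → (r + b % n) % n) (m%n%n≡m%n a n) ⟩
    (a % n + b % n) % n      ≡⟨ %-distribˡ-+ a b n ⟨
    (a + b) % n              ∎
    where open ≡-Reasoning

  %-cong-+ʳ : ∀ {a b} c → a % n ≡ b % n → (a + c) % n ≡ (b + c) % n
  %-cong-+ʳ {a} {b} c a≡b = begin
    (a + c) % n      ≡⟨ %-absorbˡ a c ⟨
    (a % n + c) % n  ≡⟨ cong (λ r → (r + c) % n) a≡b ⟩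
    (b % n + c) % n  ≡⟨ %-absorbˡ b c ⟩
    (b + c) % n      ∎
    where open ≡-Reasoning

  ∣+⇒%≡ : ∀ {a b c} → n ∣ a + c → n ∣ b + c → a % n ≡ b % n
  ∣+⇒%≡ {a} {b} {c} n∣a+c n∣b+c = begin
    a % n              ≡⟨ %-remove-+ʳ a n∣b+c ⟨
    (a + (b + c)) % n  ≡⟨ cong (_% n) (swap a b c) ⟩
    (b + (a + c)) % n  ≡⟨ %-remove-+ʳ b n∣a+c ⟩
    b % n              ∎
    where
    open ≡-Reasoning
    swap : ∀ a b c → a + (b + c) ≡ b + (a + c)
    swap = solve-∀

  %≡⇒∣+ : ∀ {a b c} → a % n ≡ b % n → n ∣ a + c → n ∣ b + c
  %≡⇒∣+ {a} {b} {c} a≡b n∣a+c =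
    m%n≡0⇒n∣m (b + c) n (trans (%-cong-+ʳ c (sym a≡b)) (n∣m⇒m%n≡0 (a + c) n n∣a+c))

  +1-%-injective : ∀ {a b} → a < n → b < n → (a + 1) % n ≡ (b + 1) % n → a ≡ b
  +1-%-injective {a} {b} a<n b<n e = begin
    a                          ≡⟨ m<n⇒m%n≡m a<n ⟨
    a % n                      ≡⟨ [m+n]%n≡m%n a n ⟨
    (a + n) % n                ≡⟨ cong (_% n) (wrap a) ⟩
    (a + 1 + (n ∸ 1)) % n      ≡⟨ %-cong-+ʳ (n ∸ 1) e ⟩
    (b + 1 + (n ∸ 1)) % n      ≡⟨ cong (_% n) (wrap b) ⟨
    (b + n) % n                ≡⟨ [m+n]%n≡m%n b n ⟩
    b % n                      ≡⟨ m<n⇒m%n≡m b<n ⟩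
    b                          ∎
    where
    open ≡-Reasoning
    wrap : ∀ x → x + n ≡ x + 1 + (n ∸ 1)
    wrap x = trans (cong (x +_) (sym (m+[n∸m]≡n (<-≤-trans z<s a<n)))) (sym (+-assoc x 1 (n ∸ 1)))

module AdditiveClosure (L : ℕ → Set) (L-+ : ∀ {x y} → L x → L y → L (x + y)) where

  L₀ : ℕ → Set
  L₀ x = x ≡ 0 ⊎ L x

  L₀-+ : ∀ {x y} → L₀ x → L₀ y → L₀ (x + y)
  L₀-+ (inj₁ refl) y∈ = y∈
  L₀-+ {x} (inj₂ x∈) (inj₁ refl) = inj₂ (subst L (sym (+-identityʳ x)) x∈)
  L₀-+ (inj₂ x∈) (inj₂ y∈) = inj₂ (L-+ x∈ y∈)

  L₀-* : ∀ c {x} → L₀ x → L₀ (c * x)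
  L₀-* zero    x∈ = inj₁ refl
  L₀-* (suc c) x∈ = L₀-+ x∈ (L₀-* c x∈)

  L₀⇒L : ∀ {x} → 0 < x → L₀ x → L x
  L₀⇒L {suc x} _ (inj₂ x∈) = x∈

  Difference : ℕ → Set
  Difference g = ∃[ q ] (L₀ q × L₀ (g + q))

  difference : ∀ {l} → L l → Difference l
  difference {l} l∈ = 0 , inj₁ refl , inj₂ (subst L (sym (+-identityʳ l)) l∈)

  private
    combine : ∀ {a b d} → Difference a → Difference b → ∀ x y → d + y * b ≡ x * a → Difference d
    combine {a} {b} {d} (qa , qa∈ , a+qa∈) (qb , qb∈ , b+qb∈) x y eq =
      y * (b + qb) + x * qa , L₀-+ (L₀-* y b+qb∈) (L₀-* x qa∈) ,
      subst L₀ (sym identity) (L₀-+ (L₀-* x a+qa∈) (L₀-* y qb∈))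
      where
      open ≡-Reasoning
      regroup : ∀ d y b qb x qa → d + (y * (b + qb) + x * qa) ≡ (d + y * b) + (x * qa + y * qb)
      regroup = solve-∀
      collect : ∀ x a qa y qb → x * a + (x * qa + y * qb) ≡ x * (a + qa) + y * qb
      collect = solve-∀
      identity : d + (y * (b + qb) + x * qa) ≡ x * (a + qa) + y * qb
      identity = begin
        d + (y * (b + qb) + x * qa)      ≡⟨ regroup d y b qb x qa ⟩
        (d + y * b) + (x * qa + y * qb)  ≡⟨ cong (_+ (x * qa + y * qb)) eq ⟩
        x * a + (x * qa + y * qb)        ≡⟨ collect x a qa y qb ⟩
        x * (a + qa) + y * qb            ∎

  difference-gcd : ∀ {a b} → Difference a → Difference b → Difference (gcd a b)
  difference-gcd {a} {b} Da Db with Bézout.identity (gcd-GCD a b)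
  ... | Bézout.+- x y eq = combine Da Db x y eq
  ... | Bézout.-+ x y eq = combine Db Da y x eq

  difference-gcdOf : ∀ {n} (f : Fin n → ℕ) → (∀ i → Difference (f i)) → Difference (gcdOf f)
  difference-gcdOf {zero}  f Df = 0 , inj₁ refl , inj₁ refl
  difference-gcdOf {suc n} f Df =
    difference-gcd (Df zero) (difference-gcdOf (λ i → f (suc i)) (λ i → Df (suc i)))

  -- For the witness c = k g with k > 0, writing t = r + s k with r < k ≤ s gives
  -- t g = (s ∸ r) · c + r · (g + c).
  large-multiples : ∀ {g} → 0 < g → (∀ {l} → L l → g ∣ l) → Difference g →
                    ∃[ K ] (∀ t → K < t → L (t * g))
  large-multiples {g} 0<g g∣L (c , c∈ , g+c∈) with g∣L₀ c∈
    where
    g∣L₀ : ∀ {x} → L₀ x → g ∣ x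
    g∣L₀ (inj₁ refl) = _ ∣0
    g∣L₀ (inj₂ x∈)   = g∣L x∈
  ... | divides zero refl =
    0 , λ t 0<t → L₀⇒L (*-mono-< 0<t 0<g) (L₀-* t (subst L₀ (+-identityʳ g) g+c∈))
  ... | divides (suc k′) refl =
    k * k , λ t kk<t → L₀⇒L (*-mono-< (≤-<-trans z≤n kk<t) 0<g)
      (subst L₀ (sym (split t (<⇒≤ kk<t))) (L₀-+ (L₀-* (t / k ∸ t % k) c∈) (L₀-* (t % k) g+c∈)))
    where
    k = suc k′
    split : ∀ t → k * k ≤ t → t * g ≡ (t / k ∸ t % k) * (k * g) + t % k * (g + k * g)
    split t kk≤t = begin
      t * g                                      ≡⟨ cong (_* g) (m≡m%n+[m/n]*n t k) ⟩
      (r + s * k) * g                            ≡⟨ cong (λ u → (r + u * k) * g) (m+[n∸m]≡n r≤s) ⟨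
      (r + (r + (s ∸ r)) * k) * g                ≡⟨ rearrange r (s ∸ r) k g ⟩
      (s ∸ r) * (k * g) + r * (g + k * g)        ∎
      where
      open ≡-Reasoning
      s = t / k
      r = t % k
      k≤s : k ≤ s
      k≤s = subst (_≤ s) (m*n/n≡m k k) (/-monoˡ-≤ k kk≤t)
      r≤s : r ≤ s
      r≤s = ≤-trans (<⇒≤ (m%n<n t k)) k≤s
      rearrange : ∀ r e k g → (r + (r + e) * k) * g ≡ e * (k * g) + r * (g + k * g)
      rearrange = solve-∀

module Walks {m : ℕ} (_⊛_ : Op m) where

  run-++ : ∀ {l k} a (xs : Vec (Fin m) l) (ys : Vec (Fin m) k) →
           run _⊛_ a (xs ++ ys) ≡ run _⊛_ (run _⊛_ a xs) ys
  run-++ a []       ys = refl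
  run-++ a (x ∷ xs) ys = run-++ (a ⊛ x) xs ys

  run-∷ʳ : ∀ {l} a (xs : Vec (Fin m) l) x → run _⊛_ a (xs ∷ʳ x) ≡ run _⊛_ a xs ⊛ x
  run-∷ʳ a []       x = refl
  run-∷ʳ a (y ∷ xs) x = run-∷ʳ (a ⊛ y) xs x

  conn-trans : ∀ {l k a b c} → ConnIn _⊛_ l a b → ConnIn _⊛_ k b c → ConnIn _⊛_ (l + k) a c
  conn-trans {l} {k} {a} (0<l , xs , refl) (_ , ys , refl) =
    <-≤-trans 0<l (m≤m+n l k) , xs ++ ys , run-++ a xs ys

  conn-step : ∀ a x → ConnIn _⊛_ 1 a (a ⊛ x)
  conn-step a x = s≤s z≤n , x ∷ [] , refl

  -- C s a b is a condition on the endpoints that survives prepending the step a → a ⊛ x₀.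
  conn-upwards-closed : (C : ℕ → Fin m → Fin m → Set) (x₀ : Fin m) →
                        (∀ {s a b} → C (suc s) a b → C s (a ⊛ x₀) b) →
                        ∀ {c} → (∀ a b → C c a b → ConnIn _⊛_ c a b) →
                        ∀ {s} → c ≤ s → ∀ a b → C s a b → ConnIn _⊛_ s a b
  conn-upwards-closed C x₀ shift {c} base c≤s = go (≤⇒≤′ c≤s)
    where
    go : ∀ {s} → c ≤′ s → ∀ a b → C s a b → ConnIn _⊛_ s a b
    go ≤′-refl         = base
    go (≤′-step c≤′s) a b cond = conn-trans (conn-step a x₀) (go c≤′s (a ⊛ x₀) b (shift cond))

module RightDivision {m : ℕ} (_⊛_ : Op m) (up : UniformityPreserving _⊛_) where

  _⊘_ : Op m
  _⊘_ = rdiv _⊛_ up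

  ⊛-⊘-cancel : ∀ a x → (a ⊛ x) ⊘ x ≡ a
  ⊛-⊘-cancel a x = proj₁ (up x) (proj₂ (proj₂ (up x) (a ⊛ x)) refl)

  ⊘-⊛-cancel : ∀ y x → (y ⊘ x) ⊛ x ≡ y
  ⊘-⊛-cancel y x = proj₂ (proj₂ (up x) y) refl

  right-translation : Fin m → Permutation′ m
  right-translation x = permutation (_⊛ x) (_⊘ x) (λ y → ⊘-⊛-cancel y x) (λ a → ⊛-⊘-cancel a x)

  run-back : ∀ {l} a (xs : Vec (Fin m) l) → Σ (Vec (Fin m) l) (λ ys → run _⊘_ (run _⊛_ a xs) ys ≡ a)
  run-back a []       = [] , refl
  run-back a (x ∷ xs) with run-back (a ⊛ x) xs
  ... | ys , back = ys ∷ʳ x , (begin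
    run _⊘_ (run _⊛_ (a ⊛ x) xs) (ys ∷ʳ x)  ≡⟨ Walks.run-∷ʳ _⊘_ _ ys x ⟩
    run _⊘_ (run _⊛_ (a ⊛ x) xs) ys ⊘ x     ≡⟨ cong (_⊘ x) back ⟩
    (a ⊛ x) ⊘ x                             ≡⟨ ⊛-⊘-cancel a x ⟩
    a                                       ∎)
    where open ≡-Reasoning

  conn-reverse : ∀ {l a b} → ConnIn _⊛_ l a b → ConnIn _⊘_ l b a
  conn-reverse {a = a} (0<l , xs , refl) = 0<l , run-back a xs

  RightInvariant : Subset m → Set
  RightInvariant S = ∀ z x → z ∈ S ⇔ z ⊛ x ∈ S

  -- A forward-closed set cannot be a proper subset of its preimage, which has the same size.
  forward-closed⇒rightInvariant : ∀ {S} → (∀ z x → z ∈ S → z ⊛ x ∈ S) → RightInvariant S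
  forward-closed⇒rightInvariant {S} forward z x = mk⇔ (forward z x) backward
    where
    S⊆preimage : S ⊆ preimage (_⊛ x) S
    S⊆preimage {y} y∈S = from (∈-preimage (_⊛ x) S) (forward y x y∈S)
    backward : z ⊛ x ∈ S → z ∈ S
    backward zx∈S = ⊆∧∣≡∣⇒⊇ S⊆preimage (sym (∣preimage∣ (right-translation x) S))
                              (from (∈-preimage (_⊛ x) S) zx∈S)

  rightInvariant-∁ : ∀ {S} → RightInvariant S → RightInvariant (∁ S)
  rightInvariant-∁ inv z x = mk⇔
    (λ z∈∁S → x∉p⇒x∈∁p (x∈∁p⇒x∉p z∈∁S ∘ from (inv z x)))
    (λ zx∈∁S → x∉p⇒x∈∁p (x∈∁p⇒x∉p zx∈∁S ∘ to (inv z x)))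

  rightInvariant⇒StarAllEq : Fin m → ∀ {S} → RightInvariant S → StarAllEq _⊛_ S
  rightInvariant⇒StarAllEq x₀ inv y = mk⇔
    (λ y∈S → y ⊘ x₀ , x₀ , from (inv _ x₀) (subst (_∈ _) (sym (⊘-⊛-cancel y x₀)) y∈S) , ⊘-⊛-cancel y x₀)
    (λ { (a , x , a∈S , refl) → to (inv a x) a∈S })

module Reachability {m : ℕ} (_⊛_ : Op m) where
  open Walks _⊛_

  Successor : Subset m → Fin m → Set
  Successor p y = ∃[ z ] (z ∈ p × ∃[ x ] z ⊛ x ≡ y)

  successor? : ∀ p → Decidable (Successor p)
  successor? p y = any? λ z → (z ∈? p) ×-dec any? λ x → z ⊛ x ≟ y

  successors : Subset m → Subset m
  successors p = tabulate λ y → does (successor? p y)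

  ∈-successors : ∀ {p y} → y ∈ successors p ⇔ Successor p y
  ∈-successors {p} = ∈-tabulate-does (successor? p)

  extend : Subset m → Subset m
  extend p = p ∪ successors p

  open Inflationary extend (λ p → p⊆p∪q (successors p))

  reachable : Fin m → Subset m
  reachable a = fold (successors ⁅ a ⁆) extend (suc m)

  reachable-sound : ∀ a k {y} → y ∈ fold (successors ⁅ a ⁆) extend k → Connectable _⊛_ a y
  reachable-sound a zero y∈ with to ∈-successors y∈
  ... | z , z∈⁅a⁆ , x , refl with x∈⁅y⁆⇒x≡y a z∈⁅a⁆
  ... | refl = 1 , conn-step a x
  reachable-sound a (suc k) {y} y∈ with x∈p∪q⁻ _ _ y∈
  ... | inj₁ y∈fold = reachable-sound a k y∈fold
  ... | inj₂ y∈succ with to ∈-successors y∈succ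
  ... | z , z∈fold , x , refl with reachable-sound a k z∈fold
  ... | l , a⇝z = l + 1 , conn-trans a⇝z (conn-step z x)

  reachable-closed : ∀ a z x → z ∈ reachable a → z ⊛ x ∈ reachable a
  reachable-closed a z x z∈ =
    fold-stable (successors ⁅ a ⁆) (x∈p∪q⁺ (inj₂ (from ∈-successors (z , z∈ , x , refl))))

  reachable-step : ∀ a x → a ⊛ x ∈ reachable a
  reachable-step a x = fold-⊇ (successors ⁅ a ⁆) (suc m) (from ∈-successors (a , x∈⁅x⁆ a , x , refl))

-- The period and the cyclic partition

module Period {m : ℕ} (_⊛_ : Op m) (up : UniformityPreserving _⊛_)
              (irreducible : Irreducible _⊛_) (a₀ : Fin m) where
  open Walks _⊛_
  open RightDivision _⊛_ up

  out back : Fin m → ℕ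
  out  x = proj₁ (irreducible a₀ x)
  back x = proj₁ (irreducible x a₀)

  out-walk : ∀ x → ConnIn _⊛_ (out x) a₀ x
  out-walk x = proj₂ (irreducible a₀ x)

  back-walk : ∀ x → ConnIn _⊛_ (back x) x a₀
  back-walk x = proj₂ (irreducible x a₀)

  cycle : Fin m → Fin (suc m) → ℕ
  cycle x zero    = out x + back x
  cycle x (suc z) = out x + 1 + back (x ⊛ z)

  cycle-closed : ∀ x j → ConnIn _⊛_ (cycle x j) a₀ a₀
  cycle-closed x zero    = conn-trans (out-walk x) (back-walk x)
  cycle-closed x (suc z) = conn-trans (conn-trans (out-walk x) (conn-step x z)) (back-walk (x ⊛ z))

  period : ℕ
  period = gcdOf λ x → gcdOf (cycle x)

  period-∣-cycle : ∀ x j → period ∣ cycle x j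
  period-∣-cycle x j = ∣-trans (gcdOf-∣ (λ x → gcdOf (cycle x)) x) (gcdOf-∣ (cycle x) j)

  -- A step x → x ⊛ z trades cycle (x ⊛ z) zero for cycle x (suc z).
  period-∣-walk : ∀ {l} x (xs : Vec (Fin m) l) → period ∣ out x + l + back (run _⊛_ x xs)
  period-∣-walk x [] = subst (period ∣_) (cong (_+ back x) (sym (+-identityʳ (out x))))
                             (period-∣-cycle x zero)
  period-∣-walk {suc l} x (z ∷ xs) =
    ∣m+n∣m⇒∣n (subst (period ∣_) (trade (out x) (back (x ⊛ z)) (out (x ⊛ z)) l (back y))
                (∣m∣n⇒∣m+n (period-∣-cycle x (suc z)) (period-∣-walk (x ⊛ z) xs)))
              (period-∣-cycle (x ⊛ z) zero)
    where
    y = run _⊛_ (x ⊛ z) xs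
    trade : ∀ a b c l d → a + 1 + b + (c + l + d) ≡ (c + b) + (a + suc l + d)
    trade = solve-∀

  period-∣-closed : ∀ {l} → ConnIn _⊛_ l a₀ a₀ → period ∣ l
  period-∣-closed {l} (_ , xs , closes) =
    ∣m+n∣m⇒∣n (subst (period ∣_) (reorder (out a₀) l (back a₀)) walk) (period-∣-cycle a₀ zero)
    where
    walk : period ∣ out a₀ + l + back a₀
    walk = subst (λ y → period ∣ out a₀ + l + back y) closes (period-∣-walk a₀ xs)
    reorder : ∀ a l b → a + l + b ≡ (a + b) + l
    reorder = solve-∀

  period-isPerAt : IsPerAt _⊛_ a₀ period
  period-isPerAt = (λ l → period-∣-closed) ,
    λ d d∣closed → gcdOf-greatest _ λ x → gcdOf-greatest (cycle x) λ j → d∣closed _ (cycle-closed x j)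

  0<period : 0 < period
  0<period = n≢0⇒n>0 λ period≡0 → <⇒≢ 0<cycle
    (sym (0∣⇒≡0 (subst (_∣ cycle a₀ zero) period≡0 (period-∣-cycle a₀ zero))))
    where
    0<cycle : 0 < cycle a₀ zero
    0<cycle = <-≤-trans (proj₁ (out-walk a₀)) (m≤m+n (out a₀) (back a₀))

  instance
    period-nonZero : NonZero period
    period-nonZero = >-nonZero 0<period

  -- The fibres of label are the classes H_i.
  label : Fin m → Fin period
  label x = fromℕ< (m%n<n (out x) period)

  toℕ-label : ∀ x → toℕ (label x) ≡ out x % period
  toℕ-label x = toℕ-fromℕ< _

  label-run : ∀ {l} x (xs : Vec (Fin m) l) → toℕ (label (run _⊛_ x xs)) ≡ (toℕ (label x) + l) % period
  label-run {l} x xs = begin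
    toℕ (label y)                     ≡⟨ toℕ-label y ⟩
    out y % period                    ≡⟨ ∣+⇒%≡ (period-∣-cycle y zero) (period-∣-walk x xs) ⟩
    (out x + l) % period              ≡⟨ %-absorbˡ (out x) l ⟨
    (out x % period + l) % period     ≡⟨ cong (λ r → (r + l) % period) (toℕ-label x) ⟨
    (toℕ (label x) + l) % period      ∎
    where
    open ≡-Reasoning
    y = run _⊛_ x xs

  next : Fin period → Fin period
  next i = fromℕ< (m%n<n (toℕ i + 1) period)

  toℕ-next : ∀ i → toℕ (next i) ≡ addMod period (toℕ i) 1
  toℕ-next i = trans (toℕ-fromℕ< _) (sym (addMod≡% period (toℕ i) 1))

  next-injective : Injective _≡_ _≡_ next
  next-injective {i} {j} e = toℕ-injective (+1-%-injective (toℕ<n i) (toℕ<n j)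
    (trans (sym (toℕ-fromℕ< _)) (trans (cong toℕ e) (toℕ-fromℕ< _))))

  label-step : ∀ x z → label (x ⊛ z) ≡ next (label x)
  label-step x z = toℕ-injective (trans (label-run x (z ∷ [])) (sym (toℕ-fromℕ< _)))

  representative : Fin period → Fin m
  representative i = run _⊛_ a₀ (replicate (toℕ i) a₀)

  label-representative : ∀ i → label (representative i) ≡ i
  label-representative i = toℕ-injective (begin
    toℕ (label (representative i))    ≡⟨ label-run a₀ (replicate (toℕ i) a₀) ⟩
    (toℕ (label a₀) + toℕ i) % period  ≡⟨ cong (λ r → (r + toℕ i) % period) label-a₀ ⟩
    toℕ i % period                    ≡⟨ m<n⇒m%n≡m (toℕ<n i) ⟩
    toℕ i                             ∎)
    where
    open ≡-Reasoning
    label-a₀ : toℕ (label a₀) ≡ 0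
    label-a₀ = trans (toℕ-label a₀) (n∣m⇒m%n≡0 (out a₀) period (period-∣-closed (out-walk a₀)))

  ∈-block : ∀ {i x} → x ∈ block label i ⇔ label x ≡ i
  ∈-block {i} = ∈-tabulate-does (λ x → label x ≟ i)

  block-nonempty : ∀ i → Nonempty (block label i)
  block-nonempty i = representative i , from ∈-block (label-representative i)

  label-successors : ∀ i y → (toℕ (label y) ≡ addMod period (toℕ i) 1 ⇔
                              (∃[ a ] ∃[ x ] (label a ≡ i × a ⊛ x ≡ y)))
  label-successors i y = mk⇔
    (λ e → y ⊘ a₀ , a₀ , next-injective (begin
       next (label (y ⊘ a₀))  ≡⟨ label-step (y ⊘ a₀) a₀ ⟨
       label ((y ⊘ a₀) ⊛ a₀)    ≡⟨ cong label (⊘-⊛-cancel y a₀) ⟩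
       label y                ≡⟨ toℕ-injective (trans e (sym (toℕ-next i))) ⟩
       next i                 ∎) , ⊘-⊛-cancel y a₀)
    (λ { (a , x , refl , refl) → trans (cong toℕ (label-step a x)) (toℕ-next (label a)) })
    where open ≡-Reasoning

  block-next : ∀ i → block label i ≡ preimage (_⊛ a₀) (block label (next i))
  block-next i = ⊆-antisym
    (λ {x} x∈ → from (∈-preimage _ _) (from ∈-block
      (trans (label-step x a₀) (cong next (to ∈-block x∈)))))
    (λ {x} x∈ → from ∈-block (next-injective
      (trans (sym (label-step x a₀)) (to ∈-block (to (∈-preimage _ _) x∈)))))

  ∣block∣-next : ∀ i → ∣ block label (next i) ∣ ≡ ∣ block label i ∣
  ∣block∣-next i = trans (sym (∣preimage∣ (right-translation a₀) (block label (next i))))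
                         (cong ∣_∣ (sym (block-next i)))

  ∣block∣-run : ∀ {l} x (xs : Vec (Fin m) l) →
                ∣ block label (label (run _⊛_ x xs)) ∣ ≡ ∣ block label (label x) ∣
  ∣block∣-run x []       = refl
  ∣block∣-run x (z ∷ xs) = begin
    ∣ block label (label (run _⊛_ (x ⊛ z) xs)) ∣  ≡⟨ ∣block∣-run (x ⊛ z) xs ⟩
    ∣ block label (label (x ⊛ z)) ∣               ≡⟨ cong (λ i → ∣ block label i ∣) (label-step x z) ⟩
    ∣ block label (next (label x)) ∣              ≡⟨ ∣block∣-next (label x) ⟩
    ∣ block label (label x) ∣                     ∎
    where open ≡-Reasoning

  ∣block∣-equal : ∀ i j → ∣ block label i ∣ ≡ ∣ block label j ∣
  ∣block∣-equal i j = trans (∣block∣≡∣block-a₀∣ i) (sym (∣block∣≡∣block-a₀∣ j))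
    where
    ∣block∣≡∣block-a₀∣ : ∀ i → ∣ block label i ∣ ≡ ∣ block label (label a₀) ∣
    ∣block∣≡∣block-a₀∣ i = trans (cong (λ i → ∣ block label i ∣) (sym (label-representative i)))
                                 (∣block∣-run a₀ (replicate (toℕ i) a₀))

  open AdditiveClosure (λ l → ConnIn _⊛_ l a₀ a₀) conn-trans

  closed-difference : Difference period
  closed-difference =
    difference-gcdOf _ λ x → difference-gcdOf (cycle x) λ j → difference (cycle-closed x j)

  private
    K : ℕ
    K = proj₁ (large-multiples 0<period period-∣-closed closed-difference)

    closed-multiple : ∀ t → K < t → ConnIn _⊛_ (t * period) a₀ a₀
    closed-multiple = proj₂ (large-multiples 0<period period-∣-closed closed-difference)

  -- D · period exceeds every out b + back a by more than K · period.
  D : ℕ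
  D = suc (K + (sum out + sum back))

  0<D*period : 0 < D * period
  0<D*period = <-≤-trans 0<period (m≤n*m period D)

  -- Walk a ⇝ a₀, loop at a₀, then a₀ ⇝ b; equal labels make the loop length a multiple of period.
  conn-same-label : ∀ a b → toℕ (label a) ≡ toℕ (label b) → ConnIn _⊛_ (D * period) a b
  conn-same-label a b same
    with %≡⇒∣+ (trans (sym (toℕ-label a)) (trans same (toℕ-label b))) (period-∣-cycle a zero)
  ... | divides k eq = subst (λ l → ConnIn _⊛_ l a b) length
                         (conn-trans (conn-trans (back-walk a) (closed-multiple t K<t)) (out-walk b))
    where
    open ≡-Reasoning
    k≤bound : k ≤ sum out + sum back
    k≤bound = ≤-trans (m≤m*n k period)
              (≤-trans (≤-reflexive (sym eq)) (+-mono-≤ (≤-sum out b) (≤-sum back a)))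
    t = D ∸ k
    K<t : K < t
    K<t = m+n≤o⇒m≤o∸n (suc K) (s≤s (+-monoʳ-≤ K k≤bound))
    k≤D : k ≤ D
    k≤D = m≤n⇒m≤1+n (≤-trans k≤bound (m≤n+m (sum out + sum back) K))
    regroup : ∀ a l b → a + l + b ≡ (b + a) + l
    regroup = solve-∀
    length : back a + t * period + out b ≡ D * period
    length = begin
      back a + t * period + out b     ≡⟨ regroup (back a) (t * period) (out b) ⟩
      out b + back a + t * period     ≡⟨ cong (_+ t * period) eq ⟩
      k * period + t * period         ≡⟨ *-distribʳ-+ period k t ⟨
      (k + t) * period                ≡⟨ cong (_* period) (m+[n∸m]≡n k≤D) ⟩
      D * period                      ∎

  goodD-D*period : GoodD _⊛_ up label (D * period)
  goodD-D*period = 0<D*period , λ a b e → conn-same-label a b (sym (begin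
    toℕ (label b)                                ≡⟨ e ⟩
    addMod period (toℕ (label a)) (D * period)   ≡⟨ addMod≡% period _ (D * period) ⟩
    (toℕ (label a) + D * period) % period        ≡⟨ [m+kn]%n≡m%n (toℕ (label a)) D period ⟩
    toℕ (label a) % period                       ≡⟨ m<n⇒m%n≡m (toℕ<n (label a)) ⟩
    toℕ (label a)                                ∎))
    where open ≡-Reasoning

  goodD-upwards-closed : ∀ {c s} → GoodD _⊛_ up label c → c ≤ s → GoodD _⊛_ up label s
  goodD-upwards-closed (0<c , conn) c≤s =
    <-≤-trans 0<c c≤s , conn-upwards-closed LabelGap a₀ shift conn c≤s
    where
    LabelGap : ℕ → Fin m → Fin m → Set
    LabelGap s a b = toℕ (label b) ≡ addMod period (toℕ (label a)) s
    shift : ∀ {s a b} → LabelGap (suc s) a b → LabelGap s (a ⊛ a₀) b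
    shift {s} {a} e = trans e (begin
      addMod period (toℕ (label a)) (suc s)          ≡⟨ addMod≡% period _ (suc s) ⟩
      (toℕ (label a) + suc s) % period               ≡⟨ cong (_% period) (+-assoc (toℕ (label a)) 1 s) ⟨
      (toℕ (label a) + 1 + s) % period               ≡⟨ %-absorbˡ (toℕ (label a) + 1) s ⟨
      ((toℕ (label a) + 1) % period + s) % period    ≡⟨ cong (λ r → (r + s) % period) (label-run a (a₀ ∷ [])) ⟨
      (toℕ (label (a ⊛ a₀)) + s) % period            ≡⟨ addMod≡% period _ s ⟨
      addMod period (toℕ (label (a ⊛ a₀))) s         ∎)
      where open ≡-Reasoning

  period≡1⇒ergodic : period ≡ 1 → Ergodic _⊛_
  period≡1⇒ergodic period≡1 = D * period , 0<D*period ,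
    λ a b → conn-same-label a b (trans (label≡0 a) (sym (label≡0 b)))
    where
    label≡0 : ∀ x → toℕ (label x) ≡ 0
    label≡0 x = n<1⇒n≡0 (subst (toℕ (label x) <_) period≡1 (toℕ<n (label x)))

module Parts {m : ℕ} (_⊛_ : Op m) (up : UniformityPreserving _⊛_) (x₀ : Fin m) where
  open Walks _⊛_
  open RightDivision _⊛_ up
  open Reachability _⊛_

  part1 : Part1 _⊛_ up
  part1 = quasigroup⇒ergodic , λ { (l , _ , conn) a b → l , conn a b }
    where
    quasigroup⇒ergodic : Quasigroup _⊛_ → Ergodic _⊛_
    quasigroup⇒ergodic (_ , left) = 1 , s≤s z≤n ,
      λ a b → s≤s z≤n , proj₁ (proj₂ (left a) b) ∷ [] , proj₂ (proj₂ (left a) b) refl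

  part2 : Part2 _⊛_ up
  part2 ¬irreducible with any? (λ a → any? (λ y → ¬? (y ∈? reachable a)))
  ... | no ∄ = contradiction irreducible ¬irreducible
    where
    irreducible : Irreducible _⊛_
    irreducible a y = reachable-sound a (suc m)
      (decidable-stable (y ∈? reachable a) (λ y∉ → ∄ (a , y , y∉)))
  ... | yes (a , y , y∉) =
    R , ∁ R , ∩-inverseʳ R , (a ⊛ a , reachable-step a a) , (y , x∉p⇒x∈∁p y∉) , p∪∁p≡⊤ R ,
    rightInvariant⇒StarAllEq a R-invariant , rightInvariant⇒StarAllEq a (rightInvariant-∁ R-invariant)
    where
    R = reachable a
    R-invariant : RightInvariant R
    R-invariant = forward-closed⇒rightInvariant (reachable-closed a)

  -- Closed walks a ⇝ b ⇝ a and a ⇝ b ⇝ b ⇝ a differ in length by any closed walk at b.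
  perAt-∣ : Irreducible _⊛_ → ∀ {a b p q} → IsPerAt _⊛_ a p → IsPerAt _⊛_ b q → p ∣ q
  perAt-∣ irreducible {a} {b} {p} p-per q-per = proj₂ q-per p λ l b⇝b →
    ∣m+n∣m⇒∣n (subst (p ∣_) (regroup i l j) (proj₁ p-per _ (conn-trans (conn-trans a⇝b b⇝b) b⇝a)))
              (proj₁ p-per _ (conn-trans a⇝b b⇝a))
    where
    i = proj₁ (irreducible a b)
    a⇝b = proj₂ (irreducible a b)
    j = proj₁ (irreducible b a)
    b⇝a = proj₂ (irreducible b a)
    regroup : ∀ i l j → i + l + j ≡ (i + j) + l
    regroup = solve-∀

  part3 : Part3 _⊛_ up
  part3 irreducible n n-per a p p-per =
    ∣-antisym (proj₂ n-per p (λ b q q-per → perAt-∣ irreducible p-per q-per)) (proj₁ n-per a p p-per)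

  part4 : Part4 _⊛_ up
  part4 irreducible n n-per
    with part3 irreducible n n-per x₀ _ (Period.period-isPerAt _⊛_ up irreducible x₀)
  ... | refl = label , block-nonempty , label-successors , ∣block∣-equal , (D * period , goodD-D*period) ,
               λ c minimal s c≤s → goodD-upwards-closed (proj₁ minimal) c≤s
    where open Period _⊛_ up irreducible x₀

  part5 : Part5 _⊛_ up
  part5 irreducible n n-per = mk⇔ (λ n≡1 → period≡1⇒ergodic (trans period≡n n≡1)) ergodic⇒n≡1
    where
    open Period _⊛_ up irreducible x₀
    period≡n : period ≡ n
    period≡n = part3 irreducible n n-per x₀ period period-isPerAt
    -- Ergodicity in l steps gives closed walks at x₀ of lengths l and l + 1.
    ergodic⇒n≡1 : Ergodic _⊛_ → n ≡ 1
    ergodic⇒n≡1 (l , _ , conn) = ∣1⇒≡1 (proj₁ n-per x₀ 1 ((λ l _ → 1∣ l) , d∣1))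
      where
      d∣1 : ∀ d → (∀ l → ConnIn _⊛_ l x₀ x₀ → d ∣ l) → d ∣ 1
      d∣1 d d∣closed =
        ∣m+n∣m⇒∣n (subst (d ∣_) (+-comm 1 l) (d∣closed (1 + l) (conn-trans (conn-step x₀ x₀) (conn _ x₀))))
                  (d∣closed l (conn x₀ x₀))

  part6 : Part6 _⊛_ up
  part6 _ c ((_ , conn) , _) s c≤s a b =
    conn-upwards-closed (λ _ _ _ → ⊤) x₀ (λ _ → tt) (λ a b _ → conn a b) c≤s a b tt

  part7 : Part7 _⊛_ up
  part7 _ c ((0<c , conn) , least) = mk⇔ c≡1⇒quasigroup quasigroup⇒c≡1
    where
    c≡1⇒quasigroup : c ≡ 1 → Quasigroup _⊛_
    c≡1⇒quasigroup refl = up , λ b →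
      section⇒injective {f = b ⊛_} {g = solution b} (solves b) ,
      λ y → solution b y , λ { refl → solves b y }
      where
      solution : Fin m → Fin m → Fin m
      solution b y with conn b y
      ... | _ , x ∷ [] , _ = x
      solves : ∀ b y → b ⊛ solution b y ≡ y
      solves b y with conn b y
      ... | _ , x ∷ [] , bx≡y = bx≡y
    quasigroup⇒c≡1 : Quasigroup _⊛_ → c ≡ 1
    quasigroup⇒c≡1 q = ≤-antisym (least 1 (s≤s z≤n) (proj₂ (proj₂ (proj₁ part1 q)))) 0<c

  part8 : Part8 _⊛_ up
  part8 = (λ irreducible a b → proj₁ (irreducible b a) , conn-reverse (proj₂ (irreducible b a)))
        , λ { (l , 0<l , conn) → l , 0<l , λ a b → conn-reverse (conn b a) }

mainTheorem6 : ∀ {m : ℕ} → 0 < m → (_*_ : Op m) → (up : UniformityPreserving _*_) →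
    Part1 _*_ up × Part2 _*_ up × Part3 _*_ up × Part4 _*_ up
      × Part5 _*_ up × Part6 _*_ up × Part7 _*_ up × Part8 _*_ up
mainTheorem6 {suc _} _ _*_ up = part1 , part2 , part3 , part4 , part5 , part6 , part7 , part8
  where open Parts _*_ up zero
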